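{- Fix a base vertex $u_0\in X$ and $x,y\in X$; let $U=x\cap y$ and $X'=\{z\in X:U\subseteq z\}$. For every $z\in X$ with $f_x(z)=f_y(z)=1$ there is a unique $z'\in X'$ such that $f_x(z')=f_y(z')=1$ and $f_{z'}(z)=1$.
   Context: $V$ is a finite-dimensional vector space over a finite field equipped with a non-degenerate form (alternating, Hermitian, or quadratic) of Witt index $d$; $X$ is the set of maximal totally isotropic subspaces of $V$ (each of dimension $d$). The dual polar graph on $X$ has $x\sim y$ iff $\dim(x\cap y)=d-1$; its path-length distance is $\partial(x,y)=d-\dim(x\cap y)$. For $w\in X$, $f_w:X\to\mathbb{R}$ is defined by $f_w(v)=1$ if $\partial(u_0,w)+\partial(w,v)=\partial(u_0,v)$ and $f_w(v)=0$ otherwise. -}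

module Defs where

open import Data.Nat as ℕ using (ℕ; suc; _∸_)
open import Data.Product using (Σ; ∃; _×_; _,_)
open import Data.Vec using (Vec; []; _∷_; zipWith; map; replicate)
open import Data.List using (List)
open import Data.List.Membership.Propositional using (_∈_)
open import Relation.Nullary using (¬_; Dec)
open import Relation.Binary.PropositionalEquality using (_≡_)
open import Algebra.Structures using (IsCommutativeRing)

record FiniteField : Set₁ where
  field
    K     : Set
    _+_   : K → K → K
    _*_   : K → K → K
    -_    : K → K
    0#    : K
    1#    : K
    isCommutativeRing : IsCommutativeRing _≡_ _+_ _*_ -_ 0# 1#
    0≢1   : ¬ (0# ≡ 1#)
    inverse : ∀ a → ¬ (a ≡ 0#) → Σ K λ b → a * b ≡ 1#
    _≟_   : (a b : K) → Dec (a ≡ b)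
    elements : List K
    complete : ∀ a → a ∈ elements

module _ (F : FiniteField) where
  open FiniteField F

  V : ℕ → Set
  V n = Vec K n

  module _ {n : ℕ} where
    _+ᵥ_ : V n → V n → V n
    _+ᵥ_ = zipWith _+_

    _·ᵥ_ : K → V n → V n
    a ·ᵥ v = map (a *_) v

    0ᵥ : V n
    0ᵥ = replicate n 0#

  lincomb : ∀ {n k} → Vec K k → Vec (V n) k → V n
  lincomb []       []       = 0ᵥ
  lincomb (a ∷ as) (b ∷ bs) = (a ·ᵥ b) +ᵥ lincomb as bs

  _∈span_ : ∀ {n k} → V n → Vec (V n) k → Set
  v ∈span b = Σ (Vec K _) λ c → lincomb c b ≡ v

  LinIndep : ∀ {n k} → Vec (V n) k → Set
  LinIndep {k = k} b = ∀ c → lincomb c b ≡ 0ᵥ → c ≡ replicate k 0#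

  SameSpan : ∀ {n k l} → Vec (V n) k → Vec (V n) l → Set
  SameSpan {n} a b = ∀ (v : V n) → (v ∈span a → v ∈span b) × (v ∈span b → v ∈span a)

  record IsBiadditive {n} (B : V n → V n → K) : Set where
    field
      addˡ : ∀ u v w → B (u +ᵥ v) w ≡ B u w + B v w
      addʳ : ∀ u v w → B u (v +ᵥ w) ≡ B u v + B u w

  NonDegenerate : ∀ {n} → (V n → V n → K) → Set
  NonDegenerate {n} B = ∀ (v : V n) → (∀ w → B v w ≡ 0#) → v ≡ 0ᵥ

  record IsAlternating {n} (B : V n → V n → K) : Set where
    field
      biadditive : IsBiadditive B
      linˡ  : ∀ a u w → B (a ·ᵥ u) w ≡ a * B u w
      linʳ  : ∀ a u w → B u (a ·ᵥ w) ≡ a * B u w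
      alt   : ∀ v → B v v ≡ 0#
      nondeg : NonDegenerate B

  record IsInvolution (σ : K → K) : Set where
    field
      σ-+  : ∀ a b → σ (a + b) ≡ σ a + σ b
      σ-*  : ∀ a b → σ (a * b) ≡ σ a * σ b
      σ-1  : σ 1# ≡ 1#
      σσ   : ∀ a → σ (σ a) ≡ a
      σ≢id : Σ K λ a → ¬ (σ a ≡ a)

  record IsHermitian {n} (σ : K → K) (B : V n → V n → K) : Set where
    field
      involution : IsInvolution σ
      biadditive : IsBiadditive B
      linˡ  : ∀ a u w → B (a ·ᵥ u) w ≡ a * B u w
      semiʳ : ∀ a u w → B u (a ·ᵥ w) ≡ σ a * B u w
      herm  : ∀ u w → B w u ≡ σ (B u w)
      nondeg : NonDegenerate B

  polar : ∀ {n} → (V n → K) → V n → V n → K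
  polar Q u v = (Q (u +ᵥ v) + (- Q u)) + (- Q v)

  record IsQuadratic {n} (Q : V n → K) : Set where
    field
      homog : ∀ a v → Q (a ·ᵥ v) ≡ (a * a) * Q v
      polar-biadditive : IsBiadditive (polar Q)
      polar-linˡ : ∀ a u w → polar Q (a ·ᵥ u) w ≡ a * polar Q u w
      nondeg : ∀ v → Q v ≡ 0# → (∀ w → polar Q v w ≡ 0#) → v ≡ 0ᵥ

  data Form (n : ℕ) : Set where
    alternating : (B : V n → V n → K) → IsAlternating B → Form n
    hermitian   : (σ : K → K) (B : V n → V n → K) → IsHermitian σ B → Form n
    quadratic   : (Q : V n → K) → IsQuadratic Q → Form n

  TotIso : ∀ {n k} → Form n → Vec (V n) k → Set
  TotIso (alternating B _) b = ∀ u v → u ∈span b → v ∈span b → B u v ≡ 0#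
  TotIso (hermitian _ B _) b = ∀ u v → u ∈span b → v ∈span b → B u v ≡ 0#
  TotIso (quadratic Q _)   b = ∀ u → u ∈span b → Q u ≡ 0#

  TISubspace : ∀ {n} → Form n → ℕ → Set
  TISubspace {n} φ k = Σ (Vec (V n) k) λ b → LinIndep b × TotIso φ b

  WittIndex : ∀ {n} → Form n → ℕ → Set
  WittIndex φ d = TISubspace φ d × ¬ TISubspace φ (suc d)

  module _ {n : ℕ} (φ : Form n) (d : ℕ) where

    -- X : maximal totally isotropic subspaces (dimension d = Witt index)
    X : Set
    X = TISubspace φ d

    basis : X → Vec (V n) d
    basis (b , _) = b

    _∈ₓ_ : V n → X → Set
    v ∈ₓ x = v ∈span basis x

    _≐_ : X → X → Set
    x ≐ y = SameSpan (basis x) (basis y)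

    DimCap : X → X → ℕ → Set
    DimCap x y k =
      (Σ (Vec (V n) k) λ b → LinIndep b × (∀ v → v ∈span b → v ∈ₓ x × v ∈ₓ y))
      × (∀ (b : Vec (V n) (suc k)) → LinIndep b → ¬ (∀ v → v ∈span b → v ∈ₓ x × v ∈ₓ y))

    Dist : X → X → ℕ → Set
    Dist x y m = Σ ℕ λ k → DimCap x y k × m ≡ d ∸ k

    -- f_w(v) = 1  for base vertex u₀, i.e. ∂(u₀,w) + ∂(w,v) = ∂(u₀,v)
    fIs1 : X → X → X → Set
    fIs1 u₀ w v = Σ ℕ λ a → Σ ℕ λ b → Σ ℕ λ c →
      Dist u₀ w a × Dist w v b × Dist u₀ v c × a ℕ.+ b ≡ c

    -- U = x ∩ y ⊆ z  (i.e. z ∈ X')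
    CapSubset : X → X → X → Set
    CapSubset x y z = ∀ v → v ∈ₓ x → v ∈ₓ y → v ∈ₓ z

-- Identify a vertex with its totally isotropic d-space. By the dimension formula, w lies between
-- p and q (∂(p,w) + ∂(w,q) = ∂(p,q)) exactly when p ∩ q ⊆ w and w = (w ∩ p) + (w ∩ q).
-- With A = x ∩ y ∩ u₀ the vertex sought is z′ = A + (z ∩ A⊥). It is totally isotropic, and
-- cutting z down to z ∩ A⊥ costs at most dim A − dim (A ∩ z) dimensions, so dim z′ ≥ d; by the
-- Witt index z′ is a vertex. The betweenness conditions for z′ then follow from those for x
-- and y, and any other admissible z″ is contained in z′, hence equal to it.
-- The linear algebra over the finite field K rests on counting: an injection K^k → K^l forces k ≤ l.
module Submission where

open import Defs
open import Algebra.Bundles using (AbelianGroup; CommutativeRing)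
import Algebra.Properties.AbelianGroup
import Algebra.Properties.CommutativeSemigroup
open import Data.Empty using (⊥-elim)
open import Data.Fin as Fin using (Fin)
import Data.Fin.Properties as Fin
open import Data.List as List using (List; length; deduplicate)
open import Data.List.Membership.Propositional using (_∈_; lose)
open import Data.List.Membership.Propositional.Properties using (∈-cartesianProductWith⁺; deduplicate-∈⇔; ∈-lookup)
open import Data.List.Relation.Unary.Any.Properties using (lookup-index)
open import Data.List.Relation.Unary.All as All using ()
open import Data.List.Relation.Unary.AllPairs using (_∷_)
open import Data.List.Relation.Unary.Any as Any using (here; any?)
open import Data.List.Relation.Unary.Unique.Propositional using (Unique)
import Data.List.Relation.Unary.Unique.DecPropositional.Properties as Unique
open import Data.Nat as ℕ using (ℕ; zero; suc; _≤_; _<_; _∸_; _^_)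
import Data.Nat.Properties as ℕₚ
open import Data.Nat.Tactic.RingSolver using (solve-∀)
open import Data.Product using (Σ; ∃; _×_; _,_; proj₁; proj₂)
open import Data.Sum using (inj₁; inj₂)
open import Data.Unit using (⊤; tt)
open import Data.Vec as Vec using (Vec; []; _∷_; zipWith; map; replicate; _++_)
import Data.Vec.Properties as Vec
open import Function.Bundles using (Equivalence)
open import Relation.Nullary using (¬_; Dec; yes; no; ¬?)
open import Relation.Nullary.Decidable using (_×-dec_; _→-dec_; decidable-stable)
open import Relation.Binary.PropositionalEquality

private variable
  n k l m : ℕ

module DistanceArithmetic where
  open import Data.Nat using (_+_)

  private
    shuffle : ∀ k₁ k₂ a₁ a₂ → (k₁ + k₂) + (a₁ + a₂) ≡ (a₁ + k₁) + (a₂ + k₂)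
    shuffle = solve-∀

    shuffle′ : ∀ d a k → d + (a + k) ≡ (d + k) + a
    shuffle′ = solve-∀

  ∸-sum⇒+-sum : ∀ {d k₀ k₁ k₂} → k₀ ≤ d → k₁ ≤ d → k₂ ≤ d →
                (d ∸ k₁) + (d ∸ k₂) ≡ d ∸ k₀ → k₁ + k₂ ≡ d + k₀
  ∸-sum⇒+-sum {d} {k₀} {k₁} {k₂} h₀ h₁ h₂ e = ℕₚ.+-cancelʳ-≡ (d ∸ k₀) (k₁ + k₂) (d + k₀) (begin
    (k₁ + k₂) + (d ∸ k₀)              ≡⟨ cong ((k₁ + k₂) +_) (sym e) ⟩
    (k₁ + k₂) + ((d ∸ k₁) + (d ∸ k₂)) ≡⟨ shuffle k₁ k₂ (d ∸ k₁) (d ∸ k₂) ⟩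
    ((d ∸ k₁) + k₁) + ((d ∸ k₂) + k₂) ≡⟨ cong₂ _+_ (ℕₚ.m∸n+n≡m h₁) (ℕₚ.m∸n+n≡m h₂) ⟩
    d + d                             ≡⟨ cong (d +_) (sym (ℕₚ.m∸n+n≡m h₀)) ⟩
    d + ((d ∸ k₀) + k₀)               ≡⟨ shuffle′ d (d ∸ k₀) k₀ ⟩
    (d + k₀) + (d ∸ k₀)               ∎)
    where open ≡-Reasoning

  +-sum⇒∸-sum : ∀ {d k₀ k₁ k₂} → k₀ ≤ d → k₁ ≤ d → k₂ ≤ d →
                k₁ + k₂ ≡ d + k₀ → (d ∸ k₁) + (d ∸ k₂) ≡ d ∸ k₀
  +-sum⇒∸-sum {d} {k₀} {k₁} {k₂} h₀ h₁ h₂ e = ℕₚ.+-cancelʳ-≡ (k₁ + k₂) _ _ (begin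
    ((d ∸ k₁) + (d ∸ k₂)) + (k₁ + k₂) ≡⟨ trans (ℕₚ.+-comm _ (k₁ + k₂)) (shuffle k₁ k₂ (d ∸ k₁) (d ∸ k₂)) ⟩
    ((d ∸ k₁) + k₁) + ((d ∸ k₂) + k₂) ≡⟨ cong₂ _+_ (ℕₚ.m∸n+n≡m h₁) (ℕₚ.m∸n+n≡m h₂) ⟩
    d + d                             ≡⟨ cong (d +_) (sym (ℕₚ.m∸n+n≡m h₀)) ⟩
    d + ((d ∸ k₀) + k₀)               ≡⟨ trans (shuffle′ d (d ∸ k₀) k₀) (ℕₚ.+-comm (d + k₀) _) ⟩
    (d ∸ k₀) + (d + k₀)               ≡⟨ cong ((d ∸ k₀) +_) (sym e) ⟩
    (d ∸ k₀) + (k₁ + k₂)              ∎)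
    where open ≡-Reasoning

  +-squeeze : ∀ {a b c e} → a ≤ b → c ≤ e → a + c ≡ b + e → a ≡ b × c ≡ e
  +-squeeze {a} ab ce eq with ℕₚ.m≤n⇒m<n∨m≡n ab
  ... | inj₂ refl = refl , ℕₚ.+-cancelˡ-≡ a _ _ eq
  ... | inj₁ a<b  = ⊥-elim (ℕₚ.<⇒≱ (ℕₚ.+-mono-<-≤ a<b ce) (ℕₚ.≤-reflexive (sym eq)))

open DistanceArithmetic

lookup-injective : ∀ {A : Set} {xs : List A} → Unique xs → ∀ i j → List.lookup xs i ≡ List.lookup xs j → i ≡ j
lookup-injective (_  ∷ _) Fin.zero    Fin.zero    _ = refl
lookup-injective (x∉ ∷ _) Fin.zero    (Fin.suc j) e = ⊥-elim (All.lookup x∉ (∈-lookup j) e)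
lookup-injective (x∉ ∷ _) (Fin.suc i) Fin.zero    e = ⊥-elim (All.lookup x∉ (∈-lookup i) (sym e))
lookup-injective (_  ∷ u) (Fin.suc i) (Fin.suc j) e = cong Fin.suc (lookup-injective u i j e)

distinct⇒2≤ : ∀ (i j : Fin m) → i ≢ j → 2 ≤ m
distinct⇒2≤ {suc zero}    Fin.zero Fin.zero i≢j = ⊥-elim (i≢j refl)
distinct⇒2≤ {suc (suc m)} _        _        _   = ℕ.s≤s (ℕ.s≤s ℕ.z≤n)

module _ (F : FiniteField) where
  open FiniteField F

  fieldRing : CommutativeRing _ _
  fieldRing = record { isCommutativeRing = isCommutativeRing }

  open CommutativeRing fieldRing using
    ( +-assoc; +-comm; +-identityˡ; +-identityʳ; -‿inverseˡ; -‿inverseʳ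
    ; *-assoc; *-comm; *-identityˡ; *-identityʳ; distribˡ; distribʳ; zeroˡ; zeroʳ)
  open import Algebra.Properties.Ring (CommutativeRing.ring fieldRing) using
    (-1*x≈-x; -0#≈0#; x+x≈x⇒x≈0)

  infixl 6 _⊕_ _⊖_
  infixr 7 _·_
  infix  8 ⊝_

  _⊕_ : V F n → V F n → V F n
  _⊕_ = _+ᵥ_ F

  _·_ : K → V F n → V F n
  _·_ = _·ᵥ_ F

  𝟘 : V F n
  𝟘 = 0ᵥ F

  ⊝_ : V F n → V F n
  ⊝_ = map -_

  _⊖_ : V F n → V F n → V F n
  u ⊖ v = u ⊕ ⊝ v

  vecAbelianGroup : ℕ → AbelianGroup _ _
  vecAbelianGroup n = record
    { Carrier = V F n ; _≈_ = _≡_ ; _∙_ = _⊕_ ; ε = 𝟘 ; _⁻¹ = ⊝_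
    ; isAbelianGroup = record
      { isGroup = record
        { isMonoid = record
          { isSemigroup = record
            { isMagma = record { isEquivalence = isEquivalence ; ∙-cong = cong₂ _⊕_ }
            ; assoc = Vec.zipWith-assoc +-assoc }
          ; identity = Vec.zipWith-identityˡ +-identityˡ , Vec.zipWith-identityʳ +-identityʳ }
        ; inverse = Vec.zipWith-inverseˡ -‿inverseˡ , Vec.zipWith-inverseʳ -‿inverseʳ
        ; ⁻¹-cong = cong ⊝_ }
      ; comm = Vec.zipWith-comm +-comm } }

  module VecGroup {n} = AbelianGroup (vecAbelianGroup n)
  module VecGroupₚ {n} = Algebra.Properties.AbelianGroup (vecAbelianGroup n)
  module VecSemigroupₚ {n} = Algebra.Properties.CommutativeSemigroup (VecGroup.commutativeSemigroup {n})

  open VecGroup using () renaming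
    (assoc to ⊕-assoc; comm to ⊕-comm; identityˡ to ⊕-identityˡ; identityʳ to ⊕-identityʳ; inverseʳ to ⊖-self)
  open VecGroupₚ using () renaming
    (//-rightDividesˡ to ⊖-⊕-cancel; //-rightDividesʳ to ⊕-⊖-cancel; inverseˡ-unique to ⊕≡𝟘⇒≡⊝)
  open VecSemigroupₚ using () renaming (interchange to ⊕-interchange; x∙yz≈y∙xz to ⊕-exchange)

  ⊕-cancelʳ : ∀ (u v w : V F n) → u ⊕ w ≡ v ⊕ w → u ≡ v
  ⊕-cancelʳ u v w e = trans (sym (⊕-⊖-cancel w u)) (trans (cong (_⊖ w) e) (⊕-⊖-cancel w v))

  ⊕≡⊕⇒⊖≡⊖ : ∀ {p q p′ q′ : V F n} → p ⊕ q ≡ p′ ⊕ q′ → p ⊖ p′ ≡ q′ ⊖ q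
  ⊕≡⊕⇒⊖≡⊖ {p = p} {q} {p′} {q′} e = ⊕-cancelʳ _ _ (p′ ⊕ q) (begin
    (p ⊖ p′) ⊕ (p′ ⊕ q)   ≡⟨ sym (⊕-assoc (p ⊖ p′) p′ q) ⟩
    ((p ⊖ p′) ⊕ p′) ⊕ q   ≡⟨ cong (_⊕ q) (⊖-⊕-cancel p′ p) ⟩
    p ⊕ q                 ≡⟨ e ⟩
    p′ ⊕ q′               ≡⟨ ⊕-comm p′ q′ ⟩
    q′ ⊕ p′               ≡⟨ cong (_⊕ p′) (sym (⊖-⊕-cancel q q′)) ⟩
    ((q′ ⊖ q) ⊕ q) ⊕ p′   ≡⟨ ⊕-assoc (q′ ⊖ q) q p′ ⟩
    (q′ ⊖ q) ⊕ (q ⊕ p′)   ≡⟨ cong ((q′ ⊖ q) ⊕_) (⊕-comm q p′) ⟩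
    (q′ ⊖ q) ⊕ (p′ ⊕ q)   ∎)
    where open ≡-Reasoning

  ·-distribˡ-⊕ : ∀ a (u v : V F n) → a · (u ⊕ v) ≡ a · u ⊕ a · v
  ·-distribˡ-⊕ a []      []      = refl
  ·-distribˡ-⊕ a (b ∷ u) (c ∷ v) = cong₂ _∷_ (distribˡ a b c) (·-distribˡ-⊕ a u v)

  ·-distribʳ-+ : ∀ a b (v : V F n) → (a + b) · v ≡ a · v ⊕ b · v
  ·-distribʳ-+ a b []      = refl
  ·-distribʳ-+ a b (c ∷ v) = cong₂ _∷_ (distribʳ c a b) (·-distribʳ-+ a b v)

  ·-assoc : ∀ a b (v : V F n) → a · (b · v) ≡ (a * b) · v
  ·-assoc a b []      = refl
  ·-assoc a b (c ∷ v) = cong₂ _∷_ (sym (*-assoc a b c)) (·-assoc a b v)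

  ·-identityˡ : ∀ (v : V F n) → 1# · v ≡ v
  ·-identityˡ []      = refl
  ·-identityˡ (a ∷ v) = cong₂ _∷_ (*-identityˡ a) (·-identityˡ v)

  ·-zeroˡ : ∀ (v : V F n) → 0# · v ≡ 𝟘
  ·-zeroˡ []      = refl
  ·-zeroˡ (a ∷ v) = cong₂ _∷_ (zeroˡ a) (·-zeroˡ v)

  ·-zeroʳ : ∀ a → a · 𝟘 {n} ≡ 𝟘
  ·-zeroʳ {n} a = trans (Vec.map-replicate (a *_) 0# n) (cong (replicate n) (zeroʳ a))

  -1·≡⊝ : ∀ (v : V F n) → (- 1#) · v ≡ ⊝ v
  -1·≡⊝ = Vec.map-cong -1*x≈-x

  lc : Vec K k → Vec (V F n) k → V F n
  lc = lincomb F

  infix 4 _∈⟨_⟩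
  _∈⟨_⟩ : V F n → Vec (V F n) k → Set
  _∈⟨_⟩ = _∈span_ F

  Independent : Vec (V F n) k → Set
  Independent = LinIndep F

  0s : Vec K k
  0s = replicate _ 0#

  lc-+ : ∀ (α β : Vec K k) (b : Vec (V F n) k) → lc (zipWith _+_ α β) b ≡ lc α b ⊕ lc β b
  lc-+ []      []      []      = sym (⊕-identityˡ 𝟘)
  lc-+ (a ∷ α) (c ∷ β) (v ∷ b) =
    trans (cong₂ _⊕_ (·-distribʳ-+ a c v) (lc-+ α β b)) (⊕-interchange (a · v) (c · v) (lc α b) (lc β b))

  lc-· : ∀ a (α : Vec K k) (b : Vec (V F n) k) → lc (map (a *_) α) b ≡ a · lc α b
  lc-· a []      []      = sym (·-zeroʳ a)
  lc-· a (c ∷ α) (v ∷ b) =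
    trans (cong₂ _⊕_ (sym (·-assoc a c v)) (lc-· a α b)) (sym (·-distribˡ-⊕ a (c · v) (lc α b)))

  lc-0s : ∀ (b : Vec (V F n) k) → lc 0s b ≡ 𝟘
  lc-0s []      = refl
  lc-0s (v ∷ b) = trans (cong₂ _⊕_ (·-zeroˡ v) (lc-0s b)) (⊕-identityˡ 𝟘)

  lc-++ : ∀ (α : Vec K k) (β : Vec K m) (b : Vec (V F n) k) (c : Vec (V F n) m) →
          lc (α ++ β) (b ++ c) ≡ lc α b ⊕ lc β c
  lc-++ []      β []      c = sym (⊕-identityˡ _)
  lc-++ (a ∷ α) β (v ∷ b) c = trans (cong (a · v ⊕_) (lc-++ α β b c)) (sym (⊕-assoc (a · v) (lc α b) (lc β c)))

  ∈⟨⟩-𝟘 : ∀ (b : Vec (V F n) k) → 𝟘 ∈⟨ b ⟩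
  ∈⟨⟩-𝟘 b = 0s , lc-0s b

  ∈⟨⟩-⊕ : ∀ {b : Vec (V F n) k} {u v} → u ∈⟨ b ⟩ → v ∈⟨ b ⟩ → u ⊕ v ∈⟨ b ⟩
  ∈⟨⟩-⊕ {b = b} (α , refl) (β , refl) = zipWith _+_ α β , lc-+ α β b

  ∈⟨⟩-· : ∀ {b : Vec (V F n) k} a {u} → u ∈⟨ b ⟩ → a · u ∈⟨ b ⟩
  ∈⟨⟩-· {b = b} a (α , refl) = map (a *_) α , lc-· a α b

  ∈⟨⟩-++ˡ : ∀ {b : Vec (V F n) k} (c : Vec (V F n) m) {u} → u ∈⟨ b ⟩ → u ∈⟨ b ++ c ⟩
  ∈⟨⟩-++ˡ {b = b} c (α , refl) = α ++ 0s , trans (lc-++ α 0s b c) (trans (cong (_ ⊕_) (lc-0s c)) (⊕-identityʳ _))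

  ∈⟨⟩-++ʳ : ∀ (b : Vec (V F n) k) {c : Vec (V F n) m} {u} → u ∈⟨ c ⟩ → u ∈⟨ b ++ c ⟩
  ∈⟨⟩-++ʳ b {c} (β , refl) = 0s ++ β , trans (lc-++ 0s β b c) (trans (cong (_⊕ _) (lc-0s b)) (⊕-identityˡ _))

  ∈⟨⟩-++⁻ : ∀ (b : Vec (V F n) k) (c : Vec (V F n) m) {u} → u ∈⟨ b ++ c ⟩ →
            ∃ λ p → ∃ λ q → p ∈⟨ b ⟩ × q ∈⟨ c ⟩ × u ≡ p ⊕ q
  ∈⟨⟩-++⁻ {k = k} b c (γ , refl) with Vec.splitAt k γ
  ... | α , β , refl = lc α b , lc β c , (α , refl) , (β , refl) , lc-++ α β b c

  ∈⟨⟩-∷⁻ : ∀ {v w : V F n} {b : Vec (V F n) k} → w ∈⟨ v ∷ b ⟩ → ∃ λ a → ∃ λ r → r ∈⟨ b ⟩ × w ≡ a · v ⊕ r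
  ∈⟨⟩-∷⁻ {b = b} (a ∷ α , refl) = a , lc α b , (α , refl) , refl

  ∈⟨⟩-head : ∀ (w : V F n) (b : Vec (V F n) k) → w ∈⟨ w ∷ b ⟩
  ∈⟨⟩-head w b = 1# ∷ 0s , trans (cong₂ _⊕_ (·-identityˡ w) (lc-0s b)) (⊕-identityʳ w)

  vectors : ∀ k → List (Vec K k)
  vectors zero    = [] List.∷ List.[]
  vectors (suc k) = List.cartesianProductWith _∷_ elements (vectors k)

  ∈-vectors : ∀ (v : Vec K k) → v ∈ vectors k
  ∈-vectors []      = here refl
  ∈-vectors (a ∷ v) = ∈-cartesianProductWith⁺ _∷_ (complete a) (∈-vectors v)

  ∃? : {P : Vec K k → Set} → (∀ v → Dec (P v)) → Dec (∃ P)
  ∃? {k} P? with any? P? (vectors k)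
  ... | yes p = yes (Any.satisfied p)
  ... | no ¬p = no λ (v , pv) → ¬p (lose (∈-vectors v) pv)

  ∀? : {P : Vec K k → Set} → (∀ v → Dec (P v)) → Dec (∀ v → P v)
  ∀? P? with ∃? (λ v → ¬? (P? v))
  ... | yes (v , ¬pv) = no λ f → ¬pv (f v)
  ... | no ¬∃         = yes λ v → decidable-stable (P? v) λ ¬pv → ¬∃ (v , ¬pv)

  _≟ᵥ_ : (u v : V F n) → Dec (u ≡ v)
  _≟ᵥ_ = Vec.≡-dec _≟_

  _∈⟨_⟩? : ∀ (v : V F n) (b : Vec (V F n) k) → Dec (v ∈⟨ b ⟩)
  v ∈⟨ b ⟩? = ∃? λ α → lc α b ≟ᵥ v

  module Counting where
    private
      distinct : List K
      distinct = deduplicate _≟_ elements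

      q : ℕ
      q = length distinct

      code : K → Fin q
      code a = Any.index (Equivalence.to (deduplicate-∈⇔ _≟_) (complete a))

      decode : Fin q → K
      decode = List.lookup distinct

      decode-code : ∀ a → decode (code a) ≡ a
      decode-code a = sym (lookup-index (Equivalence.to (deduplicate-∈⇔ _≟_) (complete a)))

      code-injective : ∀ {a b} → code a ≡ code b → a ≡ b
      code-injective {a} {b} e = trans (sym (decode-code a)) (trans (cong decode e) (decode-code b))

      encodeVec : Vec K k → Fin (q ^ k)
      encodeVec []      = Fin.zero
      encodeVec (a ∷ v) = Fin.combine (code a) (encodeVec v)

      decodeVec : Fin (q ^ k) → Vec K k
      decodeVec {zero}  _ = []
      decodeVec {suc k} i = decode (proj₁ (Fin.remQuot {q} (q ^ k) i)) ∷ decodeVec (proj₂ (Fin.remQuot {q} (q ^ k) i))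

      encodeVec-injective : ∀ (u v : Vec K k) → encodeVec u ≡ encodeVec v → u ≡ v
      encodeVec-injective []      []      _ = refl
      encodeVec-injective (a ∷ u) (b ∷ v) e with Fin.combine-injective (code a) (encodeVec u) (code b) (encodeVec v) e
      ... | eₐ , eᵤ = cong₂ _∷_ (code-injective eₐ) (encodeVec-injective u v eᵤ)

      decodeVec-injective : ∀ (i j : Fin (q ^ k)) → decodeVec {k} i ≡ decodeVec j → i ≡ j
      decodeVec-injective {zero}  Fin.zero Fin.zero _ = refl
      decodeVec-injective {suc k} i j e = begin
        i                                           ≡⟨ sym (Fin.combine-remQuot {q} (q ^ k) i) ⟩
        Fin.combine (proj₁ (rq i)) (proj₂ (rq i))   ≡⟨ cong₂ Fin.combine head≡ tail≡ ⟩
        Fin.combine (proj₁ (rq j)) (proj₂ (rq j))   ≡⟨ Fin.combine-remQuot {q} (q ^ k) j ⟩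
        j                                           ∎
        where
        open ≡-Reasoning
        rq = Fin.remQuot {q} (q ^ k)
        head≡ : proj₁ (rq i) ≡ proj₁ (rq j)
        head≡ = lookup-injective (Unique.deduplicate-! _≟_ elements) _ _ (cong Vec.head e)
        tail≡ : proj₂ (rq i) ≡ proj₂ (rq j)
        tail≡ = decodeVec-injective {k} (proj₂ (rq i)) (proj₂ (rq j)) (cong (Vec.tail {n = k}) e)

      2≤q : 2 ≤ q
      2≤q = distinct⇒2≤ (code 0#) (code 1#) λ e → 0≢1 (code-injective e)

    injection⇒≤ : (g : Vec K k → Vec K l) → (∀ u v → g u ≡ g v → u ≡ v) → k ≤ l
    injection⇒≤ {k} {l} g g-inj =
      ℕₚ.≮⇒≥ λ l<k → ℕₚ.<⇒≱ (ℕₚ.^-monoʳ-< q 2≤q l<k) (Fin.injective⇒≤ {f = transport} transport-injective)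
      where
      transport : Fin (q ^ k) → Fin (q ^ l)
      transport i = encodeVec (g (decodeVec {k} i))
      transport-injective : ∀ {i j} → transport i ≡ transport j → i ≡ j
      transport-injective e = decodeVec-injective {k} _ _ (g-inj _ _ (encodeVec-injective _ _ e))

  open Counting

  0s-++ : 0s {k ℕ.+ m} ≡ 0s {k} ++ 0s {m}
  0s-++ {zero}  = refl
  0s-++ {suc k} = cong (0# ∷_) (0s-++ {k})

  ++≡0s : ∀ (α : Vec K k) (β : Vec K m) → α ++ β ≡ 0s → α ≡ 0s × β ≡ 0s
  ++≡0s {k} {m} α β e = Vec.++-injectiveˡ α 0s e′ , Vec.++-injectiveʳ α 0s e′
    where e′ = trans e (0s-++ {k} {m})

  lc-⊝ : ∀ (α : Vec K k) (b : Vec (V F n) k) → lc (⊝ α) b ≡ ⊝ lc α b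
  lc-⊝ α b = trans (cong (λ γ → lc γ b) (sym (-1·≡⊝ α))) (trans (lc-· (- 1#) α b) (-1·≡⊝ _))

  lc-injective : ∀ {b : Vec (V F n) k} → Independent b → ∀ α β → lc α b ≡ lc β b → α ≡ β
  lc-injective {b = b} ind α β e = VecGroupₚ.x∙y⁻¹≈ε⇒x≈y α β (ind (α ⊖ β) (begin
    lc (α ⊖ β) b          ≡⟨ lc-+ α (⊝ β) b ⟩
    lc α b ⊕ lc (⊝ β) b   ≡⟨ cong (lc α b ⊕_) (lc-⊝ β b) ⟩
    lc α b ⊖ lc β b       ≡⟨ cong (_⊖ lc β b) e ⟩
    lc β b ⊖ lc β b       ≡⟨ ⊖-self (lc β b) ⟩
    𝟘                     ∎))
    where open ≡-Reasoning

  Independent-∷ : ∀ {w : V F n} {b : Vec (V F n) k} → Independent b → ¬ (w ∈⟨ b ⟩) → Independent (w ∷ b)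
  Independent-∷ {w = w} {b} ind w∉b (a ∷ α) e with a ≟ 0#
  ... | yes refl = cong (0# ∷_) (ind α (trans (sym (⊕-identityˡ (lc α b))) (trans (cong (_⊕ lc α b) (sym (·-zeroˡ w))) e)))
  ... | no a≢0   = ⊥-elim (w∉b (map (c *_) (⊝ α) , w≡))
    where
    c = proj₁ (inverse a a≢0)
    w≡ : lc (map (c *_) (⊝ α)) b ≡ w
    w≡ = begin
      lc (map (c *_) (⊝ α)) b   ≡⟨ trans (lc-· c (⊝ α) b) (cong (c ·_) (lc-⊝ α b)) ⟩
      c · ⊝ lc α b              ≡⟨ cong (c ·_) (sym (⊕≡𝟘⇒≡⊝ (a · w) (lc α b) e)) ⟩
      c · (a · w)               ≡⟨ ·-assoc c a w ⟩
      (c * a) · w               ≡⟨ cong (_· w) (trans (*-comm c a) (proj₂ (inverse a a≢0))) ⟩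
      1# · w                    ≡⟨ ·-identityˡ w ⟩
      w                         ∎
      where open ≡-Reasoning

  independent⇒≤ : ∀ (b : Vec (V F n) k) (c : Vec (V F n) l) → Independent b → (∀ v → v ∈⟨ b ⟩ → v ∈⟨ c ⟩) → k ≤ l
  independent⇒≤ b c ind b⊆c = injection⇒≤ coeffs coeffs-injective
    where
    coeffs : Vec K _ → Vec K _
    coeffs α = proj₁ (b⊆c (lc α b) (α , refl))
    coeffs-injective : ∀ α β → coeffs α ≡ coeffs β → α ≡ β
    coeffs-injective α β e = lc-injective ind α β (begin
      lc α b                ≡⟨ sym (proj₂ (b⊆c (lc α b) (α , refl))) ⟩
      lc (coeffs α) c       ≡⟨ cong (λ γ → lc γ c) e ⟩
      lc (coeffs β) c       ≡⟨ proj₂ (b⊆c (lc β b) (β , refl)) ⟩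
      lc β b                ∎)
      where open ≡-Reasoning

  standardBasis : ∀ n → Vec (V F n) n
  standardBasis zero    = []
  standardBasis (suc n) = (1# ∷ 𝟘) ∷ map (0# ∷_) (standardBasis n)

  lc-map-0∷ : ∀ (α : Vec K k) (b : Vec (V F n) k) → lc α (map (0# ∷_) b) ≡ 0# ∷ lc α b
  lc-map-0∷ []      []      = refl
  lc-map-0∷ (c ∷ α) (w ∷ b) = trans (cong (c · (0# ∷ w) ⊕_) (lc-map-0∷ α b)) (cong (_∷ (c · w ⊕ lc α b)) (trans (+-identityʳ _) (zeroʳ c)))

  lc-standardBasis : ∀ (α : Vec K n) → lc α (standardBasis n) ≡ α
  lc-standardBasis []      = refl
  lc-standardBasis (a ∷ α) = trans (cong (a · (1# ∷ 𝟘) ⊕_) (lc-map-0∷ α (standardBasis _))) (cong₂ _∷_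
    (trans (+-identityʳ _) (*-identityʳ a))
    (trans (cong (_⊕ lc α (standardBasis _)) (·-zeroʳ a)) (trans (⊕-identityˡ _) (lc-standardBasis α))))

  independent⇒≤n : ∀ (b : Vec (V F n) k) → Independent b → k ≤ n
  independent⇒≤n {n} b ind = independent⇒≤ b (standardBasis n) ind λ v _ → v , lc-standardBasis v

  record Subspace (n : ℕ) : Set₁ where
    infix 4 _∋_
    field
      _∋_ : V F n → Set
      ∋?  : ∀ v → Dec (_∋_ v)
      ∋-𝟘 : _∋_ 𝟘
      ∋-⊕ : ∀ {u v} → _∋_ u → _∋_ v → _∋_ (u ⊕ v)
      ∋-· : ∀ a {u} → _∋_ u → _∋_ (a · u)
  open Subspace public

  infix 4 _⊆_
  _⊆_ : Subspace n → Subspace n → Set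
  S ⊆ T = ∀ v → S ∋ v → T ∋ v

  ⟨_⟩ : Vec (V F n) k → Subspace n
  ⟨ b ⟩ = record { _∋_ = _∈⟨ b ⟩ ; ∋? = _∈⟨ b ⟩? ; ∋-𝟘 = ∈⟨⟩-𝟘 b ; ∋-⊕ = ∈⟨⟩-⊕ ; ∋-· = ∈⟨⟩-· }

  infixr 7 _∩ₛ_
  infixr 6 _+ₛ_

  _∩ₛ_ : Subspace n → Subspace n → Subspace n
  S ∩ₛ T = record
    { _∋_ = λ v → S ∋ v × T ∋ v
    ; ∋?  = λ v → ∋? S v ×-dec ∋? T v
    ; ∋-𝟘 = ∋-𝟘 S , ∋-𝟘 T
    ; ∋-⊕ = λ (su , tu) (sv , tv) → ∋-⊕ S su sv , ∋-⊕ T tu tv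
    ; ∋-· = λ a (su , tu) → ∋-· S a su , ∋-· T a tu }

  _+ₛ_ : Subspace n → Subspace n → Subspace n
  S +ₛ T = record
    { _∋_ = λ v → ∃ λ s → ∃ λ t → S ∋ s × T ∋ t × v ≡ s ⊕ t
    ; ∋?  = λ v → ∃? λ s → ∃? λ t → ∋? S s ×-dec ∋? T t ×-dec (v ≟ᵥ (s ⊕ t))
    ; ∋-𝟘 = 𝟘 , 𝟘 , ∋-𝟘 S , ∋-𝟘 T , sym (⊕-identityˡ 𝟘)
    ; ∋-⊕ = λ { (s , t , Ss , Tt , refl) (s′ , t′ , Ss′ , Tt′ , refl) →
                s ⊕ s′ , t ⊕ t′ , ∋-⊕ S Ss Ss′ , ∋-⊕ T Tt Tt′ , ⊕-interchange s t s′ t′ }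
    ; ∋-· = λ { a (s , t , Ss , Tt , refl) → a · s , a · t , ∋-· S a Ss , ∋-· T a Tt , ·-distribˡ-⊕ a s t } }

  ∋-⊖ : ∀ (S : Subspace n) {u v} → S ∋ u → S ∋ v → S ∋ u ⊖ v
  ∋-⊖ S {v = v} Su Sv = ∋-⊕ S Su (subst (S ∋_) (-1·≡⊝ v) (∋-· S (- 1#) Sv))

  ⟨∷⟩⊆ : ∀ (S : Subspace n) {v} {b : Vec (V F n) k} → S ∋ v → ⟨ b ⟩ ⊆ S → ⟨ v ∷ b ⟩ ⊆ S
  ⟨∷⟩⊆ S Sv b⊆S w w∈ with ∈⟨⟩-∷⁻ w∈
  ... | a , r , r∈b , refl = ∋-⊕ S (∋-· S a Sv) (b⊆S r r∈b)

  IsBasis : Subspace n → Vec (V F n) k → Set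
  IsBasis S b = Independent b × ⟨ b ⟩ ⊆ S × S ⊆ ⟨ b ⟩

  Basis : Subspace n → ℕ → Set
  Basis {n} S k = Σ (Vec (V F n) k) (IsBasis S)

  -- The fuel never runs out: an independent family in K^n has at most n members.
  private
    extend : ∀ (S : Subspace n) (c : Vec (V F n) k) fuel (e : Vec (V F n) m) →
             Independent (e ++ c) → ⟨ e ++ c ⟩ ⊆ S → n < fuel ℕ.+ (m ℕ.+ k) →
             ∃ λ m′ → Σ (Vec (V F n) m′) λ e′ → IsBasis S (e′ ++ c)
    extend {n} {k} {m} S c fuel e ind e++c⊆S bound with ∃? (λ v → ∋? S v ×-dec ¬? (v ∈⟨ e ++ c ⟩?))
    ... | no ∄ = m , e , ind , e++c⊆S , λ v Sv → decidable-stable (v ∈⟨ e ++ c ⟩?) λ v∉ → ∄ (v , Sv , v∉)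
    ... | yes (v , Sv , v∉) with fuel
    ...   | zero  = ⊥-elim (ℕₚ.<⇒≱ bound (ℕₚ.<⇒≤ (independent⇒≤n (v ∷ e ++ c) (Independent-∷ ind v∉))))
    ...   | suc f = extend S c f (v ∷ e) (Independent-∷ ind v∉) (⟨∷⟩⊆ S Sv e++c⊆S)
                      (subst (n <_) (sym (ℕₚ.+-suc f (m ℕ.+ k))) bound)

  opaque
    extend-basis : ∀ (S : Subspace n) (c : Vec (V F n) k) → Independent c → ⟨ c ⟩ ⊆ S →
                   ∃ λ m → Σ (Vec (V F n) m) λ e → IsBasis S (e ++ c)
    extend-basis {n} {k} S c ind c⊆S = extend S c (suc n) [] ind c⊆S (ℕₚ.≤-trans (ℕₚ.n<1+n n) (ℕₚ.m≤m+n (suc n) k))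

    someBasis : ∀ (S : Subspace n) → ∃ (Basis S)
    someBasis S with extend-basis S [] (λ { [] _ → refl }) (λ { w ([] , refl) → ∋-𝟘 S })
    ... | m , e , isBasis = m ℕ.+ 0 , e ++ [] , isBasis

  dim : Subspace n → ℕ
  dim S = proj₁ (someBasis S)

  dim-basis : ∀ (S : Subspace n) → Basis S (dim S)
  dim-basis S = proj₂ (someBasis S)

  independent⊆⇒≤dim : ∀ (S : Subspace n) (c : Vec (V F n) k) → Independent c → ⟨ c ⟩ ⊆ S → k ≤ dim S
  independent⊆⇒≤dim S c ind c⊆S with dim-basis S
  ... | b , _ , _ , S⊆b = independent⇒≤ c b ind λ v v∈c → S⊆b v (c⊆S v v∈c)

  basis⇒≡dim : ∀ (S : Subspace n) → Basis S k → k ≡ dim S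
  basis⇒≡dim S (b , ind , b⊆S , S⊆b) with dim-basis S
  ... | b′ , ind′ , b′⊆S , _ = ℕₚ.≤-antisym (independent⊆⇒≤dim S b ind b⊆S) (independent⇒≤ b′ b ind′ λ v v∈b′ → S⊆b v (b′⊆S v v∈b′))

  ⊆⇒dim≤ : ∀ {S T : Subspace n} → T ⊆ S → dim T ≤ dim S
  ⊆⇒dim≤ {S = S} {T} T⊆S with dim-basis T
  ... | c , ind , c⊆T , _ = independent⊆⇒≤dim S c ind λ v v∈c → T⊆S v (c⊆T v v∈c)

  dim-cong : ∀ {S T : Subspace n} → S ⊆ T → T ⊆ S → dim S ≡ dim T
  dim-cong S⊆T T⊆S = ℕₚ.≤-antisym (⊆⇒dim≤ S⊆T) (⊆⇒dim≤ T⊆S)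

  dim≤⇒⊇ : ∀ {S T : Subspace n} → T ⊆ S → dim S ≤ dim T → S ⊆ T
  dim≤⇒⊇ {S = S} {T} T⊆S dimS≤dimT v Sv with dim-basis T
  ... | c , ind , c⊆T , T⊆c with v ∈⟨ c ⟩?
  ...   | yes v∈c = c⊆T v v∈c
  ...   | no  v∉c = ⊥-elim (ℕₚ.<⇒≱ (ℕ.s≤s dimS≤dimT)
            (independent⊆⇒≤dim S (v ∷ c) (Independent-∷ ind v∉c) (⟨∷⟩⊆ S Sv λ w w∈c → T⊆S w (c⊆T w w∈c))))

  isBasis-+ₛ : ∀ (S T : Subspace n) {c : Vec (V F n) k} (s : Vec (V F n) l) (t : Vec (V F n) m) →
               IsBasis (S ∩ₛ T) c → IsBasis S (s ++ c) → IsBasis T (t ++ c) → IsBasis (S +ₛ T) (s ++ t ++ c)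
  isBasis-+ₛ {k = k} {l} {m} S T {c} s t (_ , _ , S∩T⊆c) (ind-sc , sc⊆S , S⊆sc) (ind-tc , tc⊆T , T⊆tc) =
    independent , ⊆S+T , S+T⊆
    where
    ⊆S+T : ⟨ s ++ t ++ c ⟩ ⊆ S +ₛ T
    ⊆S+T w w∈ with ∈⟨⟩-++⁻ s (t ++ c) w∈
    ... | p , r , p∈s , r∈tc , refl = p , r , sc⊆S p (∈⟨⟩-++ˡ c p∈s) , tc⊆T r r∈tc , refl

    S+T⊆ : S +ₛ T ⊆ ⟨ s ++ t ++ c ⟩
    S+T⊆ _ (a , b , Sa , Tb , refl) with ∈⟨⟩-++⁻ s c (S⊆sc a Sa) | ∈⟨⟩-++⁻ t c (T⊆tc b Tb)
    ... | p₁ , q₁ , p₁∈s , q₁∈c , refl | p₂ , q₂ , p₂∈t , q₂∈c , refl =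
      ∈⟨⟩-⊕ (∈⟨⟩-⊕ (∈⟨⟩-++ˡ (t ++ c) p₁∈s) (∈⟨⟩-++ʳ s (∈⟨⟩-++ʳ t q₁∈c)))
            (∈⟨⟩-⊕ (∈⟨⟩-++ʳ s (∈⟨⟩-++ˡ c p₂∈t)) (∈⟨⟩-++ʳ s (∈⟨⟩-++ʳ t q₂∈c)))

    -- In a relation σ ⊕ τ ⊕ γ = 𝟘 with σ ∈ ⟨ s ⟩, τ ∈ ⟨ t ⟩, γ ∈ ⟨ c ⟩ the vector τ lies in S ∩ T = ⟨ c ⟩,
    -- so independence of t ++ c forces τ = 𝟘, and then independence of s ++ c finishes.
    independent : Independent (s ++ t ++ c)
    independent γ e with Vec.splitAt l γ
    ... | α , δ , refl with Vec.splitAt m δ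
    ...   | β , ε , refl =
      trans (cong₂ _++_ (proj₁ αε≡0s) (cong₂ _++_ β≡0s (proj₂ αε≡0s)))
            (sym (trans (0s-++ {l}) (cong (0s {l} ++_) (0s-++ {m} {k}))))
      where
      σ = lc α s
      τ = lc β t
      γᶜ = lc ε c
      τ⊕σγ≡𝟘 : τ ⊕ (σ ⊕ γᶜ) ≡ 𝟘
      τ⊕σγ≡𝟘 = trans (sym (⊕-exchange σ τ γᶜ))
                 (trans (sym (trans (lc-++ α (β ++ ε) s (t ++ c)) (cong (σ ⊕_) (lc-++ β ε t c)))) e)
      τ∈S : S ∋ τ
      τ∈S = subst (S ∋_) (sym (⊕≡𝟘⇒≡⊝ τ (σ ⊕ γᶜ) τ⊕σγ≡𝟘))
              (sc⊆S _ (⊝ (α ++ ε) , trans (lc-⊝ (α ++ ε) (s ++ c)) (cong ⊝_ (lc-++ α ε s c))))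
      τ∈c : τ ∈⟨ c ⟩
      τ∈c = S∩T⊆c τ (τ∈S , tc⊆T τ (∈⟨⟩-++ˡ c (β , refl)))
      β≡0s : β ≡ 0s
      β≡0s = proj₁ (++≡0s β _ (ind-tc (β ++ ⊝ proj₁ τ∈c) (begin
        lc (β ++ ⊝ proj₁ τ∈c) (t ++ c)   ≡⟨ lc-++ β _ t c ⟩
        τ ⊕ lc (⊝ proj₁ τ∈c) c           ≡⟨ cong (τ ⊕_) (trans (lc-⊝ (proj₁ τ∈c) c) (cong ⊝_ (proj₂ τ∈c))) ⟩
        τ ⊖ τ                            ≡⟨ ⊖-self τ ⟩
        𝟘                                ∎)))
        where open ≡-Reasoning
      αε≡0s : α ≡ 0s × ε ≡ 0s
      αε≡0s = ++≡0s α ε (ind-sc (α ++ ε) (begin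
        lc (α ++ ε) (s ++ c)   ≡⟨ lc-++ α ε s c ⟩
        σ ⊕ γᶜ                 ≡⟨ sym (⊕-identityˡ _) ⟩
        𝟘 ⊕ (σ ⊕ γᶜ)           ≡⟨ cong (_⊕ (σ ⊕ γᶜ)) (sym (trans (cong (λ β → lc β t) β≡0s) (lc-0s t))) ⟩
        τ ⊕ (σ ⊕ γᶜ)           ≡⟨ τ⊕σγ≡𝟘 ⟩
        𝟘                      ∎))
        where open ≡-Reasoning

  dim-+ₛ-∩ₛ : ∀ (S T : Subspace n) → dim (S +ₛ T) ℕ.+ dim (S ∩ₛ T) ≡ dim S ℕ.+ dim T
  dim-+ₛ-∩ₛ S T with dim-basis (S ∩ₛ T)
  ... | c , cBasis@(ind , c⊆S∩T , _)
    with extend-basis S c ind (λ v v∈c → proj₁ (c⊆S∩T v v∈c)) | extend-basis T c ind (λ v v∈c → proj₂ (c⊆S∩T v v∈c))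
  ... | l , s , sBasis | m , t , tBasis = begin
    dim (S +ₛ T) ℕ.+ dim (S ∩ₛ T)    ≡⟨ cong₂ ℕ._+_ (sym (basis⇒≡dim (S +ₛ T) (_ , isBasis-+ₛ S T s t cBasis sBasis tBasis))) refl ⟩
    l ℕ.+ (m ℕ.+ _) ℕ.+ _            ≡⟨ shuffle l m (dim (S ∩ₛ T)) ⟩
    (l ℕ.+ _) ℕ.+ (m ℕ.+ _)          ≡⟨ cong₂ ℕ._+_ (basis⇒≡dim S (_ , sBasis)) (basis⇒≡dim T (_ , tBasis)) ⟩
    dim S ℕ.+ dim T                  ∎
    where
    open ≡-Reasoning
    shuffle : ∀ a b c → a ℕ.+ (b ℕ.+ c) ℕ.+ c ≡ (a ℕ.+ c) ℕ.+ (b ℕ.+ c)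
    shuffle = solve-∀

  Independent-++ˡ : ∀ (b : Vec (V F n) k) (c : Vec (V F n) m) → Independent (b ++ c) → Independent b
  Independent-++ˡ b c ind α e = proj₁ (++≡0s α 0s (ind (α ++ 0s)
    (trans (lc-++ α 0s b c) (trans (cong₂ _⊕_ e (lc-0s c)) (⊕-identityˡ 𝟘)))))

  ≤dim⇒independent : ∀ (S : Subspace n) → k ≤ dim S → Σ (Vec (V F n) k) λ b → Independent b × ⟨ b ⟩ ⊆ S
  ≤dim⇒independent {k = k} S k≤dim with dim S | dim-basis S | ℕₚ.m≤n⇒∃[o]m+o≡n k≤dim
  ... | _ | b , ind , b⊆S , _ | _ , refl with Vec.splitAt k b
  ...   | b₁ , b₂ , refl = b₁ , Independent-++ˡ b₁ b₂ ind , λ v v∈b₁ → b⊆S v (∈⟨⟩-++ˡ b₂ v∈b₁)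

  dim⟨⟩≤ : ∀ (b : Vec (V F n) k) → dim ⟨ b ⟩ ≤ k
  dim⟨⟩≤ b with dim-basis ⟨ b ⟩
  ... | c , ind , c⊆b , _ = independent⇒≤ c b ind c⊆b

  private
    ≡0+≡0 : ∀ {a b} → a ≡ 0# → b ≡ 0# → (a + b) ≡ 0#
    ≡0+≡0 refl refl = +-identityˡ 0#

    -≡0 : ∀ {a} → a ≡ 0# → (- a) ≡ 0#
    -≡0 refl = -0#≈0#

  -- A quadratic form Q enters through its polar form; total singularity additionally asks Q v = 0.
  β : Form F n → V F n → V F n → K
  β (alternating B _) = B
  β (hermitian _ B _) = B
  β (quadratic Q _)   = polar F Q

  Singular : Form F n → V F n → Set
  Singular (alternating _ _) _ = ⊤
  Singular (hermitian _ _ _) _ = ⊤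
  Singular (quadratic Q _)   v = Q v ≡ 0#

  β-⊕ˡ : ∀ (φ : Form F n) u v w → β φ (u ⊕ v) w ≡ (β φ u w + β φ v w)
  β-⊕ˡ (alternating B h) = IsBiadditive.addˡ (IsAlternating.biadditive h)
  β-⊕ˡ (hermitian σ B h) = IsBiadditive.addˡ (IsHermitian.biadditive h)
  β-⊕ˡ (quadratic Q h)   = IsBiadditive.addˡ (IsQuadratic.polar-biadditive h)

  β-·ˡ : ∀ (φ : Form F n) a u w → β φ (a · u) w ≡ (a * β φ u w)
  β-·ˡ (alternating B h) = IsAlternating.linˡ h
  β-·ˡ (hermitian σ B h) = IsHermitian.linˡ h
  β-·ˡ (quadratic Q h)   = IsQuadratic.polar-linˡ h

  β-𝟘ˡ : ∀ (φ : Form F n) w → β φ 𝟘 w ≡ 0#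
  β-𝟘ˡ φ w = trans (cong (λ u → β φ u w) (sym (·-zeroˡ 𝟘))) (trans (β-·ˡ φ 0# 𝟘 w) (zeroˡ _))

  β-⊝ˡ : ∀ (φ : Form F n) u w → β φ (⊝ u) w ≡ (- β φ u w)
  β-⊝ˡ φ u w = trans (cong (λ x → β φ x w) (sym (-1·≡⊝ u))) (trans (β-·ˡ φ (- 1#) u w) (-1*x≈-x _))

  β-⊖·≡0 : ∀ (φ : Form F n) {u v w c} → (c * β φ v w) ≡ β φ u w → β φ (u ⊖ c · v) w ≡ 0#
  β-⊖·≡0 φ {u} {v} {w} {c} e = begin
    β φ (u ⊖ c · v) w                 ≡⟨ β-⊕ˡ φ u _ w ⟩
    (β φ u w + β φ (⊝ (c · v)) w)     ≡⟨ cong (β φ u w +_) (β-⊝ˡ φ (c · v) w) ⟩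
    (β φ u w + (- β φ (c · v) w))     ≡⟨ cong (λ x → (β φ u w + (- x))) (trans (β-·ˡ φ c v w) e) ⟩
    (β φ u w + (- β φ u w))           ≡⟨ -‿inverseʳ _ ⟩
    0#                                ∎
    where open ≡-Reasoning

  β≡0-sym : ∀ (φ : Form F n) u v → β φ u v ≡ 0# → β φ v u ≡ 0#
  β≡0-sym (alternating B h) u v e = trans (sym (+-identityˡ (B v u))) (trans (cong (_+ B v u) (sym e)) Buv+Bvu≡0)
    where
    open IsAlternating h
    open IsBiadditive biadditive
    B-self-cross : ∀ x y → B x (x ⊕ y) ≡ B x y
    B-self-cross x y = trans (addʳ x x y) (trans (cong (_+ B x y) (alt x)) (+-identityˡ _))
    B-cross-self : ∀ x y → B y (x ⊕ y) ≡ B y x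
    B-cross-self x y = trans (addʳ y x y) (trans (cong (B y x +_) (alt y)) (+-identityʳ _))
    Buv+Bvu≡0 : (B u v + B v u) ≡ 0#
    Buv+Bvu≡0 = begin
      (B u v + B v u)                ≡⟨ cong₂ _+_ (sym (B-self-cross u v)) (sym (B-cross-self u v)) ⟩
      (B u (u ⊕ v) + B v (u ⊕ v))    ≡⟨ sym (addˡ u v (u ⊕ v)) ⟩
      B (u ⊕ v) (u ⊕ v)              ≡⟨ alt (u ⊕ v) ⟩
      0#                             ∎
      where open ≡-Reasoning
  β≡0-sym (hermitian σ B h) u v e = trans (IsHermitian.herm h u v) (trans (cong σ e) σ0≡0)
    where
    open IsInvolution (IsHermitian.involution h)
    σ0≡0 : σ 0# ≡ 0#
    σ0≡0 = x+x≈x⇒x≈0 (σ 0#) (trans (sym (σ-+ 0# 0#)) (cong σ (+-identityˡ 0#)))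
  β≡0-sym (quadratic Q h) u v e = trans polar-sym e
    where
    polar-sym : polar F Q v u ≡ polar F Q u v
    polar-sym = trans (+-assoc _ _ _) (trans (cong₂ _+_ (cong Q (⊕-comm v u)) (+-comm _ _)) (sym (+-assoc _ _ _)))

  β≡0-⊕ʳ : ∀ (φ : Form F n) {u v w} → β φ u v ≡ 0# → β φ u w ≡ 0# → β φ u (v ⊕ w) ≡ 0#
  β≡0-⊕ʳ φ {u} {v} {w} uv≡0 uw≡0 =
    β≡0-sym φ _ _ (trans (β-⊕ˡ φ v w u) (≡0+≡0 (β≡0-sym φ _ _ uv≡0) (β≡0-sym φ _ _ uw≡0)))

  β≡0-·ʳ : ∀ (φ : Form F n) {u v} c → β φ u v ≡ 0# → β φ u (c · v) ≡ 0#
  β≡0-·ʳ φ {u} {v} c uv≡0 =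
    β≡0-sym φ _ _ (trans (β-·ˡ φ c v u) (trans (cong (c *_) (β≡0-sym φ _ _ uv≡0)) (zeroʳ c)))

  singular-⊕ : ∀ (φ : Form F n) u v → Singular φ u → Singular φ v → β φ u v ≡ 0# → Singular φ (u ⊕ v)
  singular-⊕ (alternating _ _) _ _ _  _  _ = tt
  singular-⊕ (hermitian _ _ _) _ _ _  _  _ = tt
  singular-⊕ (quadratic Q _)   u v Qu Qv e = begin
    Q (u ⊕ v)                              ≡⟨ sym (+-identityʳ _) ⟩
    (Q (u ⊕ v) + 0#)                       ≡⟨ cong (Q (u ⊕ v) +_) (sym (-≡0 Qu)) ⟩
    (Q (u ⊕ v) + (- Q u))                  ≡⟨ sym (+-identityʳ _) ⟩
    ((Q (u ⊕ v) + (- Q u)) + 0#)           ≡⟨ cong ((Q (u ⊕ v) + (- Q u)) +_) (sym (-≡0 Qv)) ⟩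
    ((Q (u ⊕ v) + (- Q u)) + (- Q v))      ≡⟨ e ⟩
    0#                                     ∎
    where open ≡-Reasoning

  TotallyIsotropic : Form F n → Subspace n → Set
  TotallyIsotropic φ S = (∀ u v → S ∋ u → S ∋ v → β φ u v ≡ 0#) × (∀ u → S ∋ u → Singular φ u)

  TotIso⇒TotallyIsotropic : ∀ (φ : Form F n) (b : Vec (V F n) k) → TotIso F φ b → TotallyIsotropic φ ⟨ b ⟩
  TotIso⇒TotallyIsotropic (alternating _ _) b iso = iso , λ _ _ → tt
  TotIso⇒TotallyIsotropic (hermitian _ _ _) b iso = iso , λ _ _ → tt
  TotIso⇒TotallyIsotropic (quadratic Q _)   b sing = iso , sing
    where
    iso : ∀ u v → u ∈⟨ b ⟩ → v ∈⟨ b ⟩ → polar F Q u v ≡ 0#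
    iso u v u∈b v∈b = ≡0+≡0 (≡0+≡0 (sing _ (∈⟨⟩-⊕ u∈b v∈b)) (-≡0 (sing u u∈b))) (-≡0 (sing v v∈b))

  TotallyIsotropic⇒TotIso : ∀ (φ : Form F n) (b : Vec (V F n) k) → TotallyIsotropic φ ⟨ b ⟩ → TotIso F φ b
  TotallyIsotropic⇒TotIso (alternating _ _) b = proj₁
  TotallyIsotropic⇒TotIso (hermitian _ _ _) b = proj₁
  TotallyIsotropic⇒TotIso (quadratic _ _)   b = proj₂

  module Orthogonality {n : ℕ} (φ : Form F n) where

    infix 9 _⊥
    _⊥ : Subspace n → Subspace n
    A ⊥ = record
      { _∋_ = λ v → ∀ a → A ∋ a → β φ v a ≡ 0#
      ; ∋?  = λ v → ∀? λ a → ∋? A a →-dec (β φ v a ≟ 0#)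
      ; ∋-𝟘 = λ a _ → β-𝟘ˡ φ a
      ; ∋-⊕ = λ {u} {v} u⊥ v⊥ a Aa → trans (β-⊕ˡ φ u v a) (≡0+≡0 (u⊥ a Aa) (v⊥ a Aa))
      ; ∋-· = λ c {u} u⊥ a Aa → trans (β-·ˡ φ c u a) (trans (cong (c *_) (u⊥ a Aa)) (zeroʳ c)) }

    ⊥-⟨∷⟩ : ∀ {a v} (e : Vec (V F n) m) → β φ v a ≡ 0# → ⟨ e ⟩ ⊥ ∋ v → ⟨ a ∷ e ⟩ ⊥ ∋ v
    ⊥-⟨∷⟩ e v⊥a v⊥e w w∈ with ∈⟨⟩-∷⁻ w∈
    ... | c , r , r∈e , refl = β≡0-⊕ʳ φ (β≡0-·ʳ φ c v⊥a) (v⊥e r r∈e)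

    ⊥-⟨[]⟩ : ∀ v → ⟨ [] ⟩ ⊥ ∋ v
    ⊥-⟨[]⟩ v _ ([] , refl) = β≡0-sym φ _ _ (β-𝟘ˡ φ v)

    dim-∩ₛ⊥-∷ : ∀ (S : Subspace n) a (e : Vec (V F n) m) → dim (S ∩ₛ ⟨ e ⟩ ⊥) ≤ suc (dim (S ∩ₛ ⟨ a ∷ e ⟩ ⊥))
    dim-∩ₛ⊥-∷ S a e with ∃? (λ v → ∋? (S ∩ₛ ⟨ e ⟩ ⊥) v ×-dec ¬? (β φ v a ≟ 0#))
    ... | no ∄ = ℕₚ.m≤n⇒m≤1+n (⊆⇒dim≤ λ v (Sv , v⊥e) →
            Sv , ⊥-⟨∷⟩ e (decidable-stable (β φ v a ≟ 0#) λ v⊥̸a → ∄ (v , (Sv , v⊥e) , v⊥̸a)) v⊥e)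
    ... | yes (v₀ , Cv₀ , v₀⊥̸a) = begin
      dim C                           ≤⟨ ⊆⇒dim≤ C⊆C′+L ⟩
      dim (C′ +ₛ L)                   ≤⟨ ℕₚ.m≤m+n _ _ ⟩
      dim (C′ +ₛ L) ℕ.+ dim (C′ ∩ₛ L) ≡⟨ dim-+ₛ-∩ₛ C′ L ⟩
      dim C′ ℕ.+ dim L                ≤⟨ ℕₚ.+-monoʳ-≤ (dim C′) (dim⟨⟩≤ (v₀ ∷ [])) ⟩
      dim C′ ℕ.+ 1                    ≡⟨ ℕₚ.+-comm (dim C′) 1 ⟩
      suc (dim C′)                    ∎
      where
      open ℕₚ.≤-Reasoning
      C  = S ∩ₛ ⟨ e ⟩ ⊥
      C′ = S ∩ₛ ⟨ a ∷ e ⟩ ⊥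
      L  = ⟨ v₀ ∷ [] ⟩
      b⁻¹ = proj₁ (inverse (β φ v₀ a) v₀⊥̸a)
      -- v = (v ⊖ c v₀) ⊕ c v₀ with c = β v a / β v₀ a, and v ⊖ c v₀ is orthogonal to a.
      C⊆C′+L : C ⊆ C′ +ₛ L
      C⊆C′+L v Cv = v ⊖ c · v₀ , c · v₀ , (proj₁ C∋v′ , ⊥-⟨∷⟩ e v′⊥a (proj₂ C∋v′)) ,
                    ∈⟨⟩-· c (∈⟨⟩-head v₀ []) , sym (⊖-⊕-cancel (c · v₀) v)
        where
        c = β φ v a * b⁻¹
        C∋v′ : C ∋ v ⊖ c · v₀
        C∋v′ = ∋-⊖ C Cv (∋-· C c Cv₀)
        cβv₀a≡βva : (c * β φ v₀ a) ≡ β φ v a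
        cβv₀a≡βva = trans (*-assoc _ _ _)
          (trans (cong (β φ v a *_) (trans (*-comm _ _) (proj₂ (inverse _ v₀⊥̸a)))) (*-identityʳ _))
        v′⊥a : β φ (v ⊖ c · v₀) a ≡ 0#
        v′⊥a = β-⊖·≡0 φ cβv₀a≡βva

    dim-∩ₛ⊥ : ∀ (S : Subspace n) (e : Vec (V F n) m) → dim S ≤ dim (S ∩ₛ ⟨ e ⟩ ⊥) ℕ.+ m
    dim-∩ₛ⊥ S [] = ℕₚ.≤-trans (⊆⇒dim≤ λ v Sv → Sv , ⊥-⟨[]⟩ v) (ℕₚ.m≤m+n _ 0)
    dim-∩ₛ⊥ {m = suc m} S (a ∷ e) = ℕₚ.≤-trans (dim-∩ₛ⊥ S e)
      (ℕₚ.≤-trans (ℕₚ.+-monoˡ-≤ m (dim-∩ₛ⊥-∷ S a e)) (ℕₚ.≤-reflexive (sym (ℕₚ.+-suc _ m))))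

    TotallyIsotropic-⊆ : ∀ {S T : Subspace n} → S ⊆ T → TotallyIsotropic φ T → TotallyIsotropic φ S
    TotallyIsotropic-⊆ S⊆T (isoT , singT) = (λ u v Su Sv → isoT u v (S⊆T u Su) (S⊆T v Sv)) , λ u Su → singT u (S⊆T u Su)

    TotallyIsotropic-+ₛ : ∀ (S T : Subspace n) → TotallyIsotropic φ S → TotallyIsotropic φ T →
                          (∀ s t → S ∋ s → T ∋ t → β φ t s ≡ 0#) → TotallyIsotropic φ (S +ₛ T)
    TotallyIsotropic-+ₛ S T (isoS , singS) (isoT , singT) T⊥S = iso , sing
      where
      iso : ∀ u v → S +ₛ T ∋ u → S +ₛ T ∋ v → β φ u v ≡ 0#
      iso _ _ (s , t , Ss , Tt , refl) (s′ , t′ , Ss′ , Tt′ , refl) = trans (β-⊕ˡ φ s t (s′ ⊕ t′)) (≡0+≡0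
        (β≡0-⊕ʳ φ (isoS s s′ Ss Ss′) (β≡0-sym φ _ _ (T⊥S s t′ Ss Tt′)))
        (β≡0-⊕ʳ φ (T⊥S s′ t Ss′ Tt) (isoT t t′ Tt Tt′)))
      sing : ∀ u → S +ₛ T ∋ u → Singular φ u
      sing _ (s , t , Ss , Tt , refl) = singular-⊕ φ s t (singS s Ss) (singT t Tt) (β≡0-sym φ _ _ (T⊥S s t Ss Tt))

  module Geometry {n : ℕ} (φ : Form F n) (d : ℕ) where

    open Orthogonality φ

    Vertex : Set
    Vertex = X F φ d

    ⟦_⟧ : Vertex → Subspace n
    ⟦ x ⟧ = ⟨ basis F φ d x ⟩

    dim⟦⟧ : ∀ x → dim ⟦ x ⟧ ≡ d
    dim⟦⟧ x@(b , ind , _) = sym (basis⇒≡dim ⟦ x ⟧ (b , ind , (λ _ v∈ → v∈) , λ _ v∈ → v∈))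

    ⟦⟧-totallyIsotropic : ∀ x → TotallyIsotropic φ ⟦ x ⟧
    ⟦⟧-totallyIsotropic (b , _ , iso) = TotIso⇒TotallyIsotropic φ b iso

    δ : Vertex → Vertex → ℕ
    δ x y = dim (⟦ x ⟧ ∩ₛ ⟦ y ⟧)

    δ≤d : ∀ x y → δ x y ≤ d
    δ≤d x y = ℕₚ.≤-trans (⊆⇒dim≤ λ _ → proj₁) (ℕₚ.≤-reflexive (dim⟦⟧ x))

    δ-comm : ∀ x y → δ x y ≡ δ y x
    δ-comm x y = dim-cong (λ _ (vx , vy) → vy , vx) (λ _ (vy , vx) → vx , vy)

    DimCap⇒≡δ : ∀ {x y k} → DimCap F φ d x y k → k ≡ δ x y
    DimCap⇒≡δ {x} {y} ((b , ind , b⊆) , maximal) = basis⇒≡dim (⟦ x ⟧ ∩ₛ ⟦ y ⟧) (b , ind , b⊆ , ⊆b)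
      where
      ⊆b : ⟦ x ⟧ ∩ₛ ⟦ y ⟧ ⊆ ⟨ b ⟩
      ⊆b v v∈ = decidable-stable (v ∈⟨ b ⟩?) λ v∉b → maximal (v ∷ b) (Independent-∷ ind v∉b) (⟨∷⟩⊆ (⟦ x ⟧ ∩ₛ ⟦ y ⟧) v∈ b⊆)

    DimCap-δ : ∀ x y → DimCap F φ d x y (δ x y)
    DimCap-δ x y with dim-basis (⟦ x ⟧ ∩ₛ ⟦ y ⟧)
    ... | b , ind , b⊆ , _ = (b , ind , b⊆) , λ c ind′ c⊆ → ℕₚ.1+n≰n (independent⊆⇒≤dim (⟦ x ⟧ ∩ₛ ⟦ y ⟧) c ind′ c⊆)

    fIs1⇒δ : ∀ p w q → fIs1 F φ d p w q → δ p w ℕ.+ δ w q ≡ d ℕ.+ δ p q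
    fIs1⇒δ p w q (_ , _ , _ , (k₁ , D₁ , refl) , (k₂ , D₂ , refl) , (k₀ , D₀ , refl) , e)
      rewrite DimCap⇒≡δ {p} {w} D₁ | DimCap⇒≡δ {w} {q} D₂ | DimCap⇒≡δ {p} {q} D₀ = ∸-sum⇒+-sum (δ≤d p q) (δ≤d p w) (δ≤d w q) e

    δ⇒fIs1 : ∀ p w q → δ p w ℕ.+ δ w q ≡ d ℕ.+ δ p q → fIs1 F φ d p w q
    δ⇒fIs1 p w q e = _ , _ , _ , (_ , DimCap-δ p w , refl) , (_ , DimCap-δ w q , refl) , (_ , DimCap-δ p q , refl) ,
                     +-sum⇒∸-sum (δ≤d p q) (δ≤d p w) (δ≤d w q) e

    Between : Vertex → Vertex → Vertex → Set
    Between p w q = ⟦ p ⟧ ∩ₛ ⟦ q ⟧ ⊆ ⟦ w ⟧ × ⟦ w ⟧ ⊆ ⟦ w ⟧ ∩ₛ ⟦ p ⟧ +ₛ ⟦ w ⟧ ∩ₛ ⟦ q ⟧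

    -- With S = w ∩ p and T = w ∩ q we have S + T ⊆ w and S ∩ T ⊆ p ∩ q, so by the dimension formula
    -- δ p w + δ w q ≤ d + δ p q, with equality exactly when both inclusions are equalities.
    module _ (p w q : Vertex) where
      private
        S T : Subspace n
        S = ⟦ w ⟧ ∩ₛ ⟦ p ⟧
        T = ⟦ w ⟧ ∩ₛ ⟦ q ⟧

        S+T⊆w : S +ₛ T ⊆ ⟦ w ⟧
        S+T⊆w _ (s , t , (ws , _) , (wt , _) , refl) = ∈⟨⟩-⊕ ws wt

        S∩T⊆p∩q : S ∩ₛ T ⊆ ⟦ p ⟧ ∩ₛ ⟦ q ⟧
        S∩T⊆p∩q _ ((_ , vp) , (_ , vq)) = vp , vq

        dims : dim (S +ₛ T) ℕ.+ dim (S ∩ₛ T) ≡ δ p w ℕ.+ δ w q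
        dims = trans (dim-+ₛ-∩ₛ S T) (cong (ℕ._+ δ w q) (δ-comm w p))

      fIs1⇒Between : fIs1 F φ d p w q → Between p w q
      fIs1⇒Between h = p∩q⊆w , dim≤⇒⊇ {S = ⟦ w ⟧} S+T⊆w (ℕₚ.≤-reflexive (trans (dim⟦⟧ w) (sym (proj₁ tight))))
        where
        tight = +-squeeze (ℕₚ.≤-trans (⊆⇒dim≤ S+T⊆w) (ℕₚ.≤-reflexive (dim⟦⟧ w))) (⊆⇒dim≤ S∩T⊆p∩q)
                          (trans dims (fIs1⇒δ p w q h))
        p∩q⊆w : ⟦ p ⟧ ∩ₛ ⟦ q ⟧ ⊆ ⟦ w ⟧
        p∩q⊆w v v∈ = proj₁ (proj₁ (dim≤⇒⊇ {S = ⟦ p ⟧ ∩ₛ ⟦ q ⟧} S∩T⊆p∩q (ℕₚ.≤-reflexive (sym (proj₂ tight))) v v∈))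

      Between⇒fIs1 : Between p w q → fIs1 F φ d p w q
      Between⇒fIs1 (p∩q⊆w , w⊆S+T) = δ⇒fIs1 p w q (begin
        δ p w ℕ.+ δ w q                  ≡⟨ sym dims ⟩
        dim (S +ₛ T) ℕ.+ dim (S ∩ₛ T)    ≡⟨ cong₂ ℕ._+_ (trans (dim-cong S+T⊆w w⊆S+T) (dim⟦⟧ w)) (dim-cong S∩T⊆p∩q p∩q⊆S∩T) ⟩
        d ℕ.+ δ p q                      ∎)
        where
        open ≡-Reasoning
        p∩q⊆S∩T : ⟦ p ⟧ ∩ₛ ⟦ q ⟧ ⊆ S ∩ₛ T
        p∩q⊆S∩T v (vp , vq) = (p∩q⊆w v (vp , vq) , vp) , (p∩q⊆w v (vp , vq) , vq)

    TotallyIsotropic⇒dim≤ : WittIndex F φ d → ∀ {S} → TotallyIsotropic φ S → dim S ≤ d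
    TotallyIsotropic⇒dim≤ (_ , ∄larger) {S} iso = ℕₚ.≮⇒≥ λ d<dim →
      let b , ind , b⊆S = ≤dim⇒independent S d<dim in
      ∄larger (b , ind , TotallyIsotropic⇒TotIso φ b (TotallyIsotropic-⊆ {⟨ b ⟩} {S} b⊆S iso))

    vertex : ∀ (S : Subspace n) → TotallyIsotropic φ S → dim S ≡ d → Σ Vertex λ z → ⟦ z ⟧ ⊆ S × S ⊆ ⟦ z ⟧
    vertex S iso dimS≡d with subst (Basis S) dimS≡d (dim-basis S)
    ... | b , ind , b⊆S , S⊆b = (b , ind , TotallyIsotropic⇒TotIso φ b (TotallyIsotropic-⊆ {⟨ b ⟩} {S} b⊆S iso)) , b⊆S , S⊆b

    ⟦⟧⊆⊥ : ∀ {A} x → A ⊆ ⟦ x ⟧ → ⟦ x ⟧ ⊆ A ⊥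
    ⟦⟧⊆⊥ x A⊆x v vx a Aa = proj₁ (⟦⟧-totallyIsotropic x) v a vx (A⊆x a Aa)

    module Projection (witt : WittIndex F φ d) (u x y z : Vertex)
                      (x-between : Between u x z) (y-between : Between u y z) where

      A W Z′ : Subspace n
      A  = (⟦ x ⟧ ∩ₛ ⟦ y ⟧) ∩ₛ ⟦ u ⟧
      W  = ⟦ z ⟧ ∩ₛ A ⊥
      Z′ = A +ₛ W

      A⊆x : A ⊆ ⟦ x ⟧
      A⊆x _ Aa = proj₁ (proj₁ Aa)

      A⊆y : A ⊆ ⟦ y ⟧
      A⊆y _ Aa = proj₂ (proj₁ Aa)

      A⊆u : A ⊆ ⟦ u ⟧
      A⊆u _ = proj₂

      Z′-totallyIsotropic : TotallyIsotropic φ Z′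
      Z′-totallyIsotropic = TotallyIsotropic-+ₛ A W
        (TotallyIsotropic-⊆ {A} {⟦ u ⟧} A⊆u (⟦⟧-totallyIsotropic u))
        (TotallyIsotropic-⊆ {W} {⟦ z ⟧} (λ _ → proj₁) (⟦⟧-totallyIsotropic z))
        (λ a w Aa (_ , w⊥A) → w⊥A a Aa)

      -- Extend a basis c of A ∩ z to a basis e ++ c of A; then z ∩ ⟨ e ⟩⊥ ⊆ W, and cutting z by
      -- the |e| = dim A − dim (A ∩ z) vectors of e leaves dimension at least d − |e|.
      d≤dimZ′ : d ≤ dim Z′
      d≤dimZ′ with dim-basis (A ∩ₛ ⟦ z ⟧)
      ... | c , ind , c⊆A∩z , _ with extend-basis A c ind (λ v v∈c → proj₁ (c⊆A∩z v v∈c))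
      ... | m , e , eBasis@(_ , _ , A⊆e++c) = ℕₚ.+-cancelʳ-≤ (dim (A ∩ₛ ⟦ z ⟧)) d (dim Z′) (begin
        d ℕ.+ dim (A ∩ₛ ⟦ z ⟧)                  ≤⟨ ℕₚ.+-monoˡ-≤ _ (ℕₚ.≤-trans (ℕₚ.≤-reflexive (sym (dim⟦⟧ z))) (dim-∩ₛ⊥ ⟦ z ⟧ e)) ⟩
        dim C ℕ.+ m ℕ.+ dim (A ∩ₛ ⟦ z ⟧)        ≤⟨ ℕₚ.+-monoˡ-≤ _ (ℕₚ.+-monoˡ-≤ m (⊆⇒dim≤ C⊆W)) ⟩
        dim W ℕ.+ m ℕ.+ dim (A ∩ₛ ⟦ z ⟧)        ≡⟨ trans (ℕₚ.+-assoc (dim W) m _) (ℕₚ.+-comm (dim W) _) ⟩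
        (m ℕ.+ dim (A ∩ₛ ⟦ z ⟧)) ℕ.+ dim W      ≡⟨ cong (ℕ._+ dim W) (basis⇒≡dim A (e ++ c , eBasis)) ⟩
        dim A ℕ.+ dim W                         ≡⟨ sym (dim-+ₛ-∩ₛ A W) ⟩
        dim Z′ ℕ.+ dim (A ∩ₛ W)                 ≤⟨ ℕₚ.+-monoʳ-≤ (dim Z′) (⊆⇒dim≤ λ v (Av , zv , _) → Av , zv) ⟩
        dim Z′ ℕ.+ dim (A ∩ₛ ⟦ z ⟧)             ∎)
        where
        open ℕₚ.≤-Reasoning
        C = ⟦ z ⟧ ∩ₛ ⟨ e ⟩ ⊥
        C⊆W : C ⊆ W
        C⊆W v (zv , v⊥e) = zv , v⊥A
          where
          v⊥A : ∀ a → A ∋ a → β φ v a ≡ 0#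
          v⊥A a Aa with ∈⟨⟩-++⁻ e c (A⊆e++c a Aa)
          ... | p , r , p∈e , r∈c , refl =
            β≡0-⊕ʳ φ (v⊥e p p∈e) (proj₁ (⟦⟧-totallyIsotropic z) v r zv (proj₂ (c⊆A∩z r r∈c)))

      dimZ′≡d : dim Z′ ≡ d
      dimZ′≡d = ℕₚ.≤-antisym (TotallyIsotropic⇒dim≤ witt Z′-totallyIsotropic) d≤dimZ′

      -- Opaque, as unfolding the basis behind z′ makes with-abstraction over ⟦ z′ ⟧ blow up.
      opaque
        z′ : Vertex
        z′ = proj₁ (vertex Z′ Z′-totallyIsotropic dimZ′≡d)

        z′⊆Z′ : ⟦ z′ ⟧ ⊆ Z′
        z′⊆Z′ = proj₁ (proj₂ (vertex Z′ Z′-totallyIsotropic dimZ′≡d))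

        Z′⊆z′ : Z′ ⊆ ⟦ z′ ⟧
        Z′⊆z′ = proj₂ (proj₂ (vertex Z′ Z′-totallyIsotropic dimZ′≡d))

      A⊆z′ : A ⊆ ⟦ z′ ⟧
      A⊆z′ a Aa = Z′⊆z′ a (a , 𝟘 , Aa , ∋-𝟘 W , sym (⊕-identityʳ a))

      W⊆z′ : W ⊆ ⟦ z′ ⟧
      W⊆z′ w Ww = Z′⊆z′ w (𝟘 , w , ∋-𝟘 A , Ww , sym (⊕-identityˡ w))

      -- Writing v = p ⊕ q = p′ ⊕ q′ along x and along y, p ⊖ p′ = q′ ⊖ q lies in u ∩ z ⊆ y, so p ∈ A.
      x∩y⊆Z′ : ⟦ x ⟧ ∩ₛ ⟦ y ⟧ ⊆ Z′
      x∩y⊆Z′ v (vx , vy) with proj₂ x-between v vx | proj₂ y-between v vy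
      ... | p , q , (xp , up) , (xq , zq) , refl | p′ , q′ , (yp′ , up′) , (_ , zq′) , e =
        p , q , ((xp , yp) , up) , (zq , ⟦⟧⊆⊥ {A} x A⊆x q xq) , refl
        where
        p⊖p′∈y : ⟦ y ⟧ ∋ p ⊖ p′
        p⊖p′∈y = proj₁ y-between _ (∋-⊖ ⟦ u ⟧ up up′ , subst (⟦ z ⟧ ∋_) (sym (⊕≡⊕⇒⊖≡⊖ e)) (∋-⊖ ⟦ z ⟧ zq′ zq))
        yp : ⟦ y ⟧ ∋ p
        yp = subst (⟦ y ⟧ ∋_) (⊖-⊕-cancel p′ p) (∋-⊕ ⟦ y ⟧ p⊖p′∈y yp′)

      x∩y⊆z′ : CapSubset F φ d x y z′
      x∩y⊆z′ v vx vy = Z′⊆z′ v (x∩y⊆Z′ v (vx , vy))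

      Between-z′ : ∀ w → Between u w z → A ⊆ ⟦ w ⟧ → Between u w z′
      Between-z′ w (u∩z⊆w , w⊆) A⊆w = u∩z′⊆w , w⊆′
        where
        u∩z′⊆w : ⟦ u ⟧ ∩ₛ ⟦ z′ ⟧ ⊆ ⟦ w ⟧
        u∩z′⊆w v (uv , z′v) with z′⊆Z′ v z′v
        ... | a , t , Aa , (zt , _) , refl =
          ∋-⊕ ⟦ w ⟧ (A⊆w a Aa) (u∩z⊆w t (subst (⟦ u ⟧ ∋_) (VecGroupₚ.xyx⁻¹≈y a t) (∋-⊖ ⟦ u ⟧ uv (A⊆u a Aa)) , zt))
        w⊆′ : ⟦ w ⟧ ⊆ ⟦ w ⟧ ∩ₛ ⟦ u ⟧ +ₛ ⟦ w ⟧ ∩ₛ ⟦ z′ ⟧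
        w⊆′ v wv with w⊆ v wv
        ... | p , q , wup , (wq , zq) , refl = p , q , wup , (wq , W⊆z′ q (zq , ⟦⟧⊆⊥ {A} w A⊆w q wq)) , refl

      z′-between : Between u z′ z
      z′-between = u∩z⊆z′ , z′⊆
        where
        u∩z⊆z′ : ⟦ u ⟧ ∩ₛ ⟦ z ⟧ ⊆ ⟦ z′ ⟧
        u∩z⊆z′ v (uv , zv) = W⊆z′ v (zv , ⟦⟧⊆⊥ {A} u A⊆u v uv)
        z′⊆ : ⟦ z′ ⟧ ⊆ ⟦ z′ ⟧ ∩ₛ ⟦ u ⟧ +ₛ ⟦ z′ ⟧ ∩ₛ ⟦ z ⟧
        z′⊆ v z′v with z′⊆Z′ v z′v
        ... | a , t , Aa , Wt@(zt , _) , refl = a , t , (A⊆z′ a Aa , A⊆u a Aa) , (W⊆z′ t Wt , zt) , refl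

      -- Splitting z″ along u and z shows z″ ⊆ Z′; equal dimension gives equality.
      z′-unique : ∀ z″ → CapSubset F φ d x y z″ → Between u x z″ → Between u y z″ → Between u z″ z → _≐_ F φ d z″ z′
      z′-unique z″ x∩y⊆z″ (u∩z″⊆x , _) (u∩z″⊆y , _) (_ , z″⊆) v =
        z″⊆z′ v , dim≤⇒⊇ {S = ⟦ z′ ⟧} {T = ⟦ z″ ⟧} z″⊆z′ (ℕₚ.≤-reflexive (trans (dim⟦⟧ z′) (sym (dim⟦⟧ z″)))) v
        where
        z″⊆z′ : ⟦ z″ ⟧ ⊆ ⟦ z′ ⟧
        z″⊆z′ v z″v with z″⊆ v z″v
        ... | p , q , (z″p , up) , (z″q , zq) , refl =
          Z′⊆z′ _ (p , q , ((u∩z″⊆x p (up , z″p) , u∩z″⊆y p (up , z″p)) , up) ,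
                   (zq , ⟦⟧⊆⊥ {A} z″ (λ a ((xa , ya) , _) → x∩y⊆z″ a xa ya) q z″q) , refl)

lemmaA4 : (F : FiniteField) (n : ℕ) (φ : Form F n) (d : ℕ) → WittIndex F φ d →
    (u₀ x y z : X F φ d) →
    fIs1 F φ d u₀ x z → fIs1 F φ d u₀ y z →
    Σ (X F φ d) λ z′ →
      (CapSubset F φ d x y z′ × fIs1 F φ d u₀ x z′ × fIs1 F φ d u₀ y z′ × fIs1 F φ d u₀ z′ z)
      × (∀ (z″ : X F φ d) → CapSubset F φ d x y z″ → fIs1 F φ d u₀ x z″ → fIs1 F φ d u₀ y z″ →
           fIs1 F φ d u₀ z″ z → _≐_ F φ d z″ z′)
lemmaA4 F n φ d witt u₀ x y z hx hy =
  z′ , (x∩y⊆z′ , Between⇒fIs1 u₀ x z′ (Between-z′ x x-between A⊆x) ,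
        Between⇒fIs1 u₀ y z′ (Between-z′ y y-between A⊆y) , Between⇒fIs1 u₀ z′ z z′-between) ,
  λ z″ x∩y⊆z″ hx″ hy″ hz″ →
    z′-unique z″ x∩y⊆z″ (fIs1⇒Between u₀ x z″ hx″) (fIs1⇒Between u₀ y z″ hy″) (fIs1⇒Between u₀ z″ z hz″)
  where
  open Geometry F φ d
  x-between = fIs1⇒Between u₀ x z hx
  y-between = fIs1⇒Between u₀ y z hy
  open Projection witt u₀ x y z x-between y-between
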